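{- If an instance of $2$-Visits has a feasible schedule, then it has a feasible schedule in which all secondary visits are placed at gaps (equivalently, no primary visit is placed at a gap).
   Context: $2$-Visits: given a non-decreasing sequence of positive integers $d_1,\ldots,d_n$, a feasible schedule is a sequence of length $2n$ (positions $1,\ldots,2n$) containing, for each node $i$, one primary and one secondary visit, such that the primary visit of $i$ is at a position $t_i\le d_i$ and the secondary visit of $i$ is either before its primary visit or at a position at most $t_i+d_i$. The discretized sequence $A$ is defined by $a_n=d_n$ and $a_i=\min\{a_{i+1}-1,d_i\}$ for $i<n$; a position $j\in\{1,\ldots,2n\}$ is a gap if $j\notin\{a_1,\ldots,a_n\}$. -}

module Defs where

open import Data.Nat using (ℕ; zero; suc; _≤_; _<_; _∸_; _*_; _+_; _⊓_)
open import Data.Fin using (Fin; zero; suc) renaming (_≤_ to _≤ᶠ_)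
open import Data.Sum using (_⊎_; inj₁; inj₂; [_,_])
open import Data.Product using (_×_)
open import Function using (_∘_)
open import Function.Definitions using (Injective)
open import Relation.Binary.PropositionalEquality using (_≡_; _≢_)

IsInstance : (n : ℕ) → (Fin n → ℕ) → Set
IsInstance n d = (∀ i → 1 ≤ d i) × (∀ i j → i ≤ᶠ j → d i ≤ d j)

-- A schedule assigns each node a primary position and a secondary position
-- in {1,…,2n}; all 2n visits occupy distinct positions (so the schedule is
-- a sequence of length 2n containing every visit exactly once).
record Schedule (n : ℕ) : Set where
  field
    prim : Fin n → ℕ
    sec  : Fin n → ℕ

  pos : Fin n ⊎ Fin n → ℕ
  pos = [ prim , sec ]

  field
    pos-lo  : ∀ v → 1 ≤ pos v
    pos-hi  : ∀ v → pos v ≤ 2 * n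
    pos-inj : Injective _≡_ _≡_ pos

open Schedule public

Feasible : (n : ℕ) → (Fin n → ℕ) → Schedule n → Set
Feasible n d σ =
  ∀ i → (prim σ i ≤ d i) × (sec σ i < prim σ i ⊎ sec σ i ≤ prim σ i + d i)

-- Discretized sequence A (0-indexed): a_{n-1} = d_{n-1},
-- a_i = min (a_{i+1} - 1) d_i.  Truncated subtraction on ℕ: any value that
-- would be ≤ 0 becomes 0, which never coincides with a position in 1..2n.
disc : (n : ℕ) → (Fin n → ℕ) → Fin n → ℕ
disc (suc zero) d zero = d zero
disc (suc (suc n)) d zero = (disc (suc n) (d ∘ suc) zero ∸ 1) ⊓ d zero
disc (suc (suc n)) d (suc i) = disc (suc n) (d ∘ suc) i

Gap : (n : ℕ) → (Fin n → ℕ) → ℕ → Set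
Gap n d j = (1 ≤ j) × (j ≤ 2 * n) × (∀ i → disc n d i ≢ j)

-- Repair secondary visits one at a time.  If a secondary visit sits at a
-- non-gap s = a_k, unfolding the definition of A gives a node l ≥ k with
-- d_l = a_k + (l − k).  The l − k + 1 nodes k, …, l have distinct primary
-- positions, each at most d_l and none equal to s, so by pigeonhole one of
-- them, j, has its primary visit before s.  As s = a_k ≤ d_k ≤ d_j,
-- exchanging the primary visit of j with the secondary visit at s keeps the
-- schedule feasible and strictly increases the sum of the primary positions,
-- which is bounded; so the repair terminates.

module Submission where

open import Defs
open import Data.Nat using (ℕ; zero; suc; _+_; _*_; _∸_; _≤_; _<_; z≤n; s≤s; _<?_; _≟_)
open import Data.Nat.Properties
open import Data.Fin as Fin using (Fin; zero; suc; toℕ; fromℕ<) renaming (_≤_ to _≤ᶠ_)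
import Data.Fin.Properties as Finₚ
open Finₚ using (any?)
open import Data.Product using (Σ; ∃; ∃₂; _×_; _,_; proj₁)
open import Data.Sum using (_⊎_; inj₁; inj₂; [_,_]; [_,_]′)
open import Data.Sum.Properties using (≡-dec; inj₁-injective; inj₂-injective)
open import Data.Empty using (⊥; ⊥-elim)
open import Relation.Nullary using (yes; no)
open import Relation.Binary.Definitions using (DecidableEquality)
open import Relation.Binary.PropositionalEquality hiding ([_])
open import Function using (_∘_)
open import Function.Definitions using (Injective)
open import Algebra.Properties.Monoid.Sum +-0-monoid using (sum)

no-injection-into-shorter-interval :
  ∀ {N lo} (f : Fin (suc N) → ℕ) → Injective _≡_ _≡_ f →
  (∀ x → lo ≤ f x) → (∀ x → f x < lo + N) → ⊥
no-injection-into-shorter-interval {N} {lo} f f-inj lo≤f f<lo+N =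
  let i , j , i<j , same = Finₚ.pigeonhole (n<1+n N) offset
  in Finₚ.<-irrefl (f-inj (∸-cancelʳ-≡ (lo≤f i) (lo≤f j) (offset-injective same))) i<j
  where
  offset : Fin (suc N) → Fin N
  offset x = fromℕ< (subst (f x ∸ lo <_) (m+n∸m≡n lo N) (∸-monoˡ-< (f<lo+N x) (lo≤f x)))

  offset-injective : ∀ {x y} → offset x ≡ offset y → f x ∸ lo ≡ f y ∸ lo
  offset-injective {x} {y} eq =
    trans (sym (Finₚ.toℕ-fromℕ< _)) (trans (cong toℕ eq) (Finₚ.toℕ-fromℕ< _))

module _ {n N : ℕ} (k l : Fin n) (l≡k+N : toℕ l ≡ toℕ k + N) where

  window : Fin (suc N) → Fin n
  window x = fromℕ< (≤-<-trans (+-monoʳ-≤ (toℕ k) (Finₚ.toℕ≤pred[n] x))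
                               (subst (_< n) l≡k+N (Finₚ.toℕ<n l)))

  toℕ-window : ∀ x → toℕ (window x) ≡ toℕ k + toℕ x
  toℕ-window x = Finₚ.toℕ-fromℕ< _

  window-injective : Injective _≡_ _≡_ window
  window-injective {x} {y} eq = Finₚ.toℕ-injective (+-cancelˡ-≡ (toℕ k) (toℕ x) (toℕ y)
    (trans (sym (toℕ-window x)) (trans (cong toℕ eq) (toℕ-window y))))

  window-≥ : ∀ x → k ≤ᶠ window x
  window-≥ x = subst (toℕ k ≤_) (sym (toℕ-window x)) (m≤m+n (toℕ k) (toℕ x))

  window-≤ : ∀ x → window x ≤ᶠ l
  window-≤ x = begin
    toℕ (window x)   ≡⟨ toℕ-window x ⟩
    toℕ k + toℕ x    ≤⟨ +-monoʳ-≤ (toℕ k) (Finₚ.toℕ≤pred[n] x) ⟩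
    toℕ k + N        ≡⟨ l≡k+N ⟨
    toℕ l            ∎
    where open ≤-Reasoning

disc≤d : ∀ n d k → disc n d k ≤ d k
disc≤d (suc zero) d zero = ≤-refl
disc≤d (suc (suc n)) d zero = m⊓n≤n _ _
disc≤d (suc (suc n)) d (suc k) = disc≤d (suc n) (d ∘ suc) k

[m∸1]+[1+n]≡m+n : ∀ {m} n → 1 ≤ m → (m ∸ 1) + suc n ≡ m + n
[m∸1]+[1+n]≡m+n {m} n 1≤m = trans (+-suc (m ∸ 1) n) (cong (_+ n) (m+[n∸m]≡n 1≤m))

Attained : ∀ n → (Fin n → ℕ) → Fin n → Set
Attained n d k = ∃₂ λ N l → toℕ l ≡ toℕ k + N × d l ≡ disc n d k + N

disc-attained : ∀ n d k → 1 ≤ disc n d k → Attained n d k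
disc-attained (suc zero) d zero _ = 0 , zero , refl , sym (+-identityʳ _)
disc-attained (suc n@(suc _)) d (suc k) 1≤a =
  let N , l , l≡k+N , dₗ≡a+N = disc-attained n (d ∘ suc) k 1≤a
  in N , suc l , cong suc l≡k+N , dₗ≡a+N
disc-attained (suc n@(suc _)) d zero 1≤a =
  [ through-next (disc-attained n (d ∘ suc) zero) , here ]′ (⊓-sel (a′ ∸ 1) (d zero))
  where
  a′ : ℕ
  a′ = disc n (d ∘ suc) zero

  here : disc (suc n) d zero ≡ d zero → Attained (suc n) d zero
  here a≡d₀ = 0 , zero , refl , sym (trans (+-identityʳ _) a≡d₀)

  through-next : (1 ≤ a′ → Attained n (d ∘ suc) zero) →
                 disc (suc n) d zero ≡ a′ ∸ 1 → Attained (suc n) d zero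
  through-next attained-next a≡a′∸1 =
    let 1≤a′ = ≤-trans (subst (1 ≤_) a≡a′∸1 1≤a) (m∸n≤m a′ 1)
        N , l , l≡N , dₗ≡a′+N = attained-next 1≤a′
    in suc N , suc l , cong suc l≡N , (begin
      d (suc l)                ≡⟨ dₗ≡a′+N ⟩
      a′ + N                   ≡⟨ [m∸1]+[1+n]≡m+n N 1≤a′ ⟨
      (a′ ∸ 1) + suc N         ≡⟨ cong (_+ suc N) a≡a′∸1 ⟨
      disc (suc n) d zero + suc N ∎)
    where open ≡-Reasoning

NodeFeasible : (deadline primary secondary : ℕ) → Set
NodeFeasible D t s = t ≤ D × (s < t ⊎ s ≤ t + D)

delay-primary : ∀ {D t t′ s} → t ≤ t′ → t′ ≤ D → NodeFeasible D t s → NodeFeasible D t′ s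
delay-primary t≤t′ t′≤D (_ , inj₁ s<t)   = t′≤D , inj₁ (<-≤-trans s<t t≤t′)
delay-primary t≤t′ t′≤D (_ , inj₂ s≤t+D) = t′≤D , inj₂ (≤-trans s≤t+D (+-monoˡ-≤ _ t≤t′))

advance-secondary : ∀ {D t s s′} → s′ ≤ s → NodeFeasible D t s → NodeFeasible D t s′
advance-secondary s′≤s (t≤D , inj₁ s<t)   = t≤D , inj₁ (≤-<-trans s′≤s s<t)
advance-secondary s′≤s (t≤D , inj₂ s≤t+D) = t≤D , inj₂ (≤-trans s′≤s s≤t+D)

module Transposition {A : Set} (_≟_ : DecidableEquality A) where

  transpose : A → A → A → A
  transpose u v w with w ≟ u
  ... | yes _ = v
  ... | no _ with w ≟ v
  ...   | yes _ = u
  ...   | no _  = w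

  transpose-left : ∀ u v → transpose u v u ≡ v
  transpose-left u v with u ≟ u
  ... | yes _  = refl
  ... | no u≢u = ⊥-elim (u≢u refl)

  transpose-right : ∀ u v → transpose u v v ≡ u
  transpose-right u v with v ≟ u
  ... | yes v≡u = v≡u
  ... | no _ with v ≟ v
  ...   | yes _  = refl
  ...   | no v≢v = ⊥-elim (v≢v refl)

  transpose-other : ∀ u v {w} → w ≢ u → w ≢ v → transpose u v w ≡ w
  transpose-other u v {w} w≢u w≢v with w ≟ u
  ... | yes w≡u = ⊥-elim (w≢u w≡u)
  ... | no _ with w ≟ v
  ...   | yes w≡v = ⊥-elim (w≢v w≡v)
  ...   | no _    = refl

  transpose-involutive : ∀ u v w → transpose u v (transpose u v w) ≡ w
  transpose-involutive u v w with w ≟ u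
  ... | yes refl = transpose-right u v
  ... | no w≢u with w ≟ v
  ...   | yes refl = transpose-left u v
  ...   | no w≢v   = transpose-other u v w≢u w≢v

  transpose-injective : ∀ u v → Injective _≡_ _≡_ (transpose u v)
  transpose-injective u v {x} {y} eq = begin
    x                                ≡⟨ transpose-involutive u v x ⟨
    transpose u v (transpose u v x)  ≡⟨ cong (transpose u v) eq ⟩
    transpose u v (transpose u v y)  ≡⟨ transpose-involutive u v y ⟩
    y                                ∎
    where open ≡-Reasoning

module _ {n : ℕ} where

  Visit : Set
  Visit = Fin n ⊎ Fin n

  open Transposition {A = Visit} (≡-dec Fin._≟_ Fin._≟_) public

  reindex : (σ : Schedule n) (τ : Visit → Visit) → Injective _≡_ _≡_ τ → Schedule n
  reindex σ τ τ-injective = record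
    { prim    = pos σ ∘ τ ∘ inj₁
    ; sec     = pos σ ∘ τ ∘ inj₂
    ; pos-lo  = λ v → subst (1 ≤_) (sym (pos-reindexed v)) (pos-lo σ (τ v))
    ; pos-hi  = λ v → subst (_≤ 2 * n) (sym (pos-reindexed v)) (pos-hi σ (τ v))
    ; pos-inj = λ {v} {w} eq → τ-injective (pos-inj σ
        (trans (sym (pos-reindexed v)) (trans eq (pos-reindexed w))))
    }
    where
    pos-reindexed : ∀ v → [ pos σ ∘ τ ∘ inj₁ , pos σ ∘ τ ∘ inj₂ ] v ≡ pos σ (τ v)
    pos-reindexed (inj₁ _) = refl
    pos-reindexed (inj₂ _) = refl

  -- Opaque so that case splits on x ≟ j do not rewrite inside the unfolded transpose.
  opaque
    exchange : Schedule n → (j i : Fin n) → Schedule n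
    exchange σ j i =
      reindex σ (transpose (inj₁ j) (inj₂ i)) (transpose-injective (inj₁ j) (inj₂ i))

  module _ (σ : Schedule n) (j i : Fin n) where
    opaque
      unfolding exchange

      prim-exchange-self : prim (exchange σ j i) j ≡ sec σ i
      prim-exchange-self = cong (pos σ) (transpose-left (inj₁ j) (inj₂ i))

      prim-exchange-other : ∀ {x} → x ≢ j → prim (exchange σ j i) x ≡ prim σ x
      prim-exchange-other x≢j =
        cong (pos σ) (transpose-other (inj₁ j) (inj₂ i) (x≢j ∘ inj₁-injective) λ ())

      sec-exchange-self : sec (exchange σ j i) i ≡ prim σ j
      sec-exchange-self = cong (pos σ) (transpose-right (inj₁ j) (inj₂ i))

      sec-exchange-other : ∀ {x} → x ≢ i → sec (exchange σ j i) x ≡ sec σ x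
      sec-exchange-other x≢i =
        cong (pos σ) (transpose-other (inj₁ j) (inj₂ i) (λ ()) (x≢i ∘ inj₂-injective))

  exchange-feasible : ∀ {d} σ j i → Feasible n d σ → prim σ j < sec σ i → sec σ i ≤ d j →
                      Feasible n d (exchange σ j i)
  exchange-feasible σ j i feas t<s s≤dⱼ x with x Fin.≟ j | x Fin.≟ i
  ... | yes refl | yes refl
    rewrite prim-exchange-self σ x x | sec-exchange-self σ x x = s≤dⱼ , inj₁ t<s
  ... | yes refl | no x≢i
    rewrite prim-exchange-self σ x i | sec-exchange-other σ x i x≢i =
    delay-primary (<⇒≤ t<s) s≤dⱼ (feas x)
  ... | no x≢j | yes refl
    rewrite prim-exchange-other σ j x x≢j | sec-exchange-self σ j x =
    advance-secondary (<⇒≤ t<s) (feas x)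
  ... | no x≢j | no x≢i
    rewrite prim-exchange-other σ j i x≢j | sec-exchange-other σ j i x≢i = feas x

sum-mono-≤ : ∀ {m} {f g : Fin m → ℕ} → (∀ x → f x ≤ g x) → sum f ≤ sum g
sum-mono-≤ {zero}  f≤g = z≤n
sum-mono-≤ {suc m} f≤g = +-mono-≤ (f≤g zero) (sum-mono-≤ (f≤g ∘ suc))

sum-mono-< : ∀ {m} {f g : Fin m → ℕ} → (∀ x → f x ≤ g x) → ∀ j → f j < g j → sum f < sum g
sum-mono-< f≤g zero    fⱼ<gⱼ = +-mono-<-≤ fⱼ<gⱼ (sum-mono-≤ (f≤g ∘ suc))
sum-mono-< f≤g (suc j) fⱼ<gⱼ = +-mono-≤-< (f≤g zero) (sum-mono-< (f≤g ∘ suc) j fⱼ<gⱼ)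

module _ {n : ℕ} where

  total : Schedule n → ℕ
  total σ = sum (prim σ)

  total-bounded : ∀ σ → total σ ≤ sum {n} (λ _ → 2 * n)
  total-bounded σ = sum-mono-≤ (λ x → pos-hi σ (inj₁ x))

  exchange-raises-total : ∀ σ j i → prim σ j < sec σ i → total σ < total (exchange σ j i)
  exchange-raises-total σ j i t<s =
    sum-mono-< raised j (subst (prim σ j <_) (sym (prim-exchange-self σ j i)) t<s)
    where
    raised : ∀ x → prim σ x ≤ prim (exchange σ j i) x
    raised x with x Fin.≟ j
    ... | yes refl = subst (prim σ x ≤_) (sym (prim-exchange-self σ x i)) (<⇒≤ t<s)
    ... | no x≢j   = ≤-reflexive (sym (prim-exchange-other σ j i x≢j))

  prim-injective : (σ : Schedule n) → Injective _≡_ _≡_ (prim σ)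
  prim-injective σ eq = inj₁-injective (pos-inj σ eq)

  prim≢sec : (σ : Schedule n) → ∀ j i → prim σ j ≢ sec σ i
  prim≢sec σ j i eq with pos-inj σ {inj₁ j} {inj₂ i} eq
  ... | ()

  early-primary-in-window :
    ∀ {d N} → (∀ i j → i ≤ᶠ j → d i ≤ d j) → (σ : Schedule n) → Feasible n d σ →
    ∀ i (k l : Fin n) → toℕ l ≡ toℕ k + N → d l ≡ sec σ i + N →
    ∃ λ j → k ≤ᶠ j × prim σ j < sec σ i
  early-primary-in-window {d} {N} d-mono σ feas i k l l≡k+N dₗ≡s+N
    with any? (λ x → prim σ (window k l l≡k+N x) <? sec σ i)
  ... | yes (x , t<s) = window k l l≡k+N x , window-≥ k l l≡k+N x , t<s
  -- Otherwise the N + 1 distinct primaries of the window all lie in (s, s + N].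
  ... | no none = ⊥-elim (no-injection-into-shorter-interval (prim σ ∘ node)
                           (window-injective k l l≡k+N ∘ prim-injective σ) after-s before-end)
    where
    node : Fin (suc N) → Fin n
    node = window k l l≡k+N

    after-s : ∀ x → suc (sec σ i) ≤ prim σ (node x)
    after-s x = ≤∧≢⇒< (≮⇒≥ (λ t<s → none (x , t<s))) (prim≢sec σ (node x) i ∘ sym)

    before-end : ∀ x → prim σ (node x) < suc (sec σ i) + N
    before-end x = s≤s (begin
      prim σ (node x)  ≤⟨ proj₁ (feas (node x)) ⟩
      d (node x)       ≤⟨ d-mono (node x) l (window-≤ k l l≡k+N x) ⟩
      d l              ≡⟨ dₗ≡s+N ⟩
      sec σ i + N      ∎)
      where open ≤-Reasoning

  primary-before-non-gap : ∀ {d} → IsInstance n d → (σ : Schedule n) → Feasible n d σ →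
    ∀ {i k} → disc n d k ≡ sec σ i → ∃ λ j → prim σ j < sec σ i × sec σ i ≤ d j
  primary-before-non-gap {d} (_ , d-mono) σ feas {i} {k} aₖ≡s =
    let N , l , l≡k+N , dₗ≡aₖ+N =
          disc-attained n d k (subst (1 ≤_) (sym aₖ≡s) (pos-lo σ (inj₂ i)))
        j , k≤j , t<s = early-primary-in-window d-mono σ feas i k l l≡k+N
                          (trans dₗ≡aₖ+N (cong (_+ N) aₖ≡s))
    in j , t<s , (begin
      sec σ i     ≡⟨ aₖ≡s ⟨
      disc n d k  ≤⟨ disc≤d n d k ⟩
      d k         ≤⟨ d-mono k j k≤j ⟩
      d j         ∎)
    where open ≤-Reasoning

  gaps-or-improvable : ∀ {d} → IsInstance n d → ∀ σ → Feasible n d σ →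
    (∀ i → Gap n d (sec σ i)) ⊎ ∃ λ σ′ → Feasible n d σ′ × total σ < total σ′
  gaps-or-improvable {d} inst σ feas with any? (λ i → any? (λ k → disc n d k ≟ sec σ i))
  ... | no none =
    inj₁ λ i → pos-lo σ (inj₂ i) , pos-hi σ (inj₂ i) , λ k aₖ≡s → none (i , k , aₖ≡s)
  ... | yes (i , k , aₖ≡s) =
    let j , t<s , s≤dⱼ = primary-before-non-gap inst σ feas aₖ≡s
    in inj₂ ( exchange σ j i
            , exchange-feasible σ j i feas t<s s≤dⱼ
            , exchange-raises-total σ j i t<s )

bounded-ascent : ∀ {A : Set} (P Q : A → Set) (μ : A → ℕ) (M : ℕ) → (∀ a → μ a ≤ M) →
  (∀ a → P a → Q a ⊎ ∃ λ b → P b × μ a < μ b) →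
  ∀ a → P a → ∃ λ b → P b × Q b
bounded-ascent P Q μ M μ≤M step a Pa = climb (suc M) a Pa (m≤n+m (suc M) (μ a))
  where
  climb : ∀ fuel a → P a → M < μ a + fuel → ∃ λ b → P b × Q b
  climb zero    a Pa M<μa+0 = ⊥-elim (<⇒≱ (subst (M <_) (+-identityʳ (μ a)) M<μa+0) (μ≤M a))
  climb (suc fuel) a Pa M<μa+fuel+1 with step a Pa
  ... | inj₁ Qa = a , Pa , Qa
  ... | inj₂ (b , Pb , μa<μb) = climb fuel b Pb (begin-strict
    M                 <⟨ M<μa+fuel+1 ⟩
    μ a + suc fuel    ≡⟨ +-suc (μ a) fuel ⟩
    suc (μ a) + fuel  ≤⟨ +-monoˡ-≤ fuel μa<μb ⟩
    μ b + fuel        ∎)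
    where open ≤-Reasoning

lemma5 : (n : ℕ) (d : Fin n → ℕ) → IsInstance n d →
         Σ (Schedule n) (Feasible n d) →
         Σ (Schedule n) (λ σ → Feasible n d σ × (∀ i → Gap n d (sec σ i)))
lemma5 n d inst (σ , feas) =
  bounded-ascent (Feasible n d) (λ σ → ∀ i → Gap n d (sec σ i)) total (sum {n} λ _ → 2 * n)
                 total-bounded (gaps-or-improvable inst) σ feas
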